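{- Let $\Delta$ be a matroid of rank $d$ on the ground set $[n]$ such that $[d]$ is a basis, and suppose $h_d(\Delta)\neq 0$. If $I$ is an independent set of $\Delta$ disjoint from $[d]$ such that $h_{d-|I|}(\Gamma_I)=0$, then there exists $z\in[n]-([d]\cup I)$ such that $I\cup\{z\}$ is independent in $\Delta$.
   Context: $\Gamma_I$ is the matroid on $[d]$ whose independent sets are the subsets $G\subseteq[d]$ with $G\cup I$ independent in $\Delta$; it has rank $d-|I|$. For a matroid $M$ of rank $r$, its $h$-vector $(h_0,\dots,h_r)$ is defined by $\sum_{i=0}^r h_i y^{r-i}=\sum_{i=0}^r f_i(y-1)^{r-i}$, where $f_i$ is the number of independent sets of size $i$ (equivalently, $h_i$ is the number of bases whose restriction set in a lexicographic shelling has size $i$). -}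

module Defs where

open import Data.Bool using (Bool; true; false)
open import Data.Nat using (ℕ; zero; suc; _≤_; _<_; _∸_; _≟_; _<?_)
open import Data.Nat.Combinatorics using (_C_)
open import Data.Fin using (Fin; toℕ; fromℕ<)
open import Data.Fin.Subset using (Subset; _∈_; _∉_; _⊆_; _∪_; ⁅_⁆; ⊥; ∣_∣)
open import Data.Vec using (Vec; []; _∷_; tabulate; lookup)
open import Data.List using (List; []; _∷_; map; _++_; upTo; filter; length)
open import Data.Integer as ℤ using (ℤ; +_)
open import Data.Product using (Σ; ∃; _×_; _,_)
open import Relation.Nullary using (¬_; Dec; yes; no)
open import Relation.Unary using (Pred; Decidable)
open import Relation.Binary.PropositionalEquality using (_≡_)
open import Function using (case_of_)
open import Level using (0ℓ)

record Matroid (m : ℕ) : Set₁ where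
  field
    Indep    : Subset m → Set
    indep?   : (S : Subset m) → Dec (Indep S)
    indep-⊥  : Indep ⊥
    indep-⊆  : ∀ {A B} → A ⊆ B → Indep B → Indep A
    augment  : ∀ {A B} → Indep A → Indep B → ∣ A ∣ < ∣ B ∣ →
               ∃ λ x → x ∈ B × x ∉ A × Indep (A ∪ ⁅ x ⁆)

allSubsets : (m : ℕ) → List (Subset m)
allSubsets zero    = [] ∷ []
allSubsets (suc m) = map (false ∷_) (allSubsets m) ++ map (true ∷_) (allSubsets m)

fCount : {m : ℕ} (P : Subset m → Set) → ((S : Subset m) → Dec (P S)) → ℕ → ℕ
fCount {m} P P? i = length (filter dec (allSubsets m))
  where
  dec : (S : Subset m) → Dec (P S × ∣ S ∣ ≡ i)
  dec S with P? S | ∣ S ∣ ≟ i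
  ... | yes p | yes q = yes (p , q)
  ... | no ¬p | _     = no λ { (p , _) → ¬p p }
  ... | yes _ | no ¬q = no λ { (_ , q) → ¬q q }

sumℤ : List ℤ → ℤ
sumℤ []       = + 0
sumℤ (x ∷ xs) = x ℤ.+ sumℤ xs

sign : ℕ → ℤ
sign zero          = + 1
sign (suc zero)    = ℤ.- (+ 1)
sign (suc (suc k)) = sign k

-- h-vector entry h_k of a complex of rank r with f-vector f, i.e. the
-- coefficient of y^(r-k) in  Σ_{i=0}^{r} f_i (y-1)^(r-i):
--   h_k = Σ_{i=0}^{k} (-1)^(k-i) * C(r-i, k-i) * f_i .
hEntry : (r : ℕ) → (f : ℕ → ℕ) → ℕ → ℤ
hEntry r f k = sumℤ (map term (upTo (suc k)))
  where
  term : ℕ → ℤ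
  term i = sign (k ∸ i) ℤ.* (+ ((r ∸ i) C (k ∸ i))) ℤ.* (+ f i)

fVec : {m : ℕ} → Matroid m → ℕ → ℕ
fVec M = fCount (Matroid.Indep M) (Matroid.indep? M)

hVec : {m : ℕ} → Matroid m → (r : ℕ) → ℕ → ℤ
hVec M r = hEntry r (fVec M)

-- The subset [d] = {0,…,d-1} of Fin n (elements j with toℕ j < d).
initSeg : (n d : ℕ) → Subset n
initSeg n d = tabulate λ j → case toℕ j <? d of λ { (yes _) → true ; (no _) → false }

embed : {n d : ℕ} → Subset d → Subset n
embed {n} {d} G = tabulate λ j → case toℕ j <? d of λ
  { (yes p) → lookup G (fromℕ< p) ; (no _) → false }

IsBasis : {m : ℕ} → Matroid m → Subset m → Set
IsBasis M B = Matroid.Indep M B × (∀ x → x ∉ B → ¬ Matroid.Indep M (B ∪ ⁅ x ⁆))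

-- Γ_I : on ground set [d], G independent iff G ∪ I independent in Δ.
-- Only its f-vector / h-vector are needed; h-vector computed with rank d - |I|.
ΓIndep : {n d : ℕ} → Matroid n → Subset n → Subset d → Set
ΓIndep Δ I G = Matroid.Indep Δ (embed G ∪ I)

ΓIndep? : {n d : ℕ} (Δ : Matroid n) (I : Subset n) → (G : Subset d) → Dec (ΓIndep Δ I G)
ΓIndep? Δ I G = Matroid.indep? Δ (embed G ∪ I)

hΓ : {n : ℕ} (d : ℕ) → Matroid n → Subset n → ℕ → ℤ
hΓ {n} d Δ I = hEntry (d ∸ ∣ I ∣) (fCount {d} (ΓIndep Δ I) (ΓIndep? Δ I))

-- For an independence system M of rank r containing an independent r-set, the top h-number
-- h_r(M) equals Σ_S (-1)^(r-|S|) over the independent sets S. A coloop e makes this sum vanish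
-- (S ↦ S ∪ {e} pairs off the terms), and for a matroid deletion–contraction at one element shows
-- that the sum is positive unless M has a coloop. Hence h_{d-|I|}(Γ_I) = 0 gives a coloop g of Γ_I.
-- If no z ∉ [d] ∪ I could be added to I, every independent set containing I would lie in I ∪ [d],
-- so g would lie in every basis of Δ: a coloop of Δ, contradicting h_d(Δ) ≠ 0.

module Submission where

open import Defs
open import Data.Bool using (true; false)
open import Data.Nat as ℕ using (ℕ; zero; suc; _≤_; _<_; _∸_; z≤n; s≤s; s≤s⁻¹; _<ᵇ_; _≤?_; _<?_)
import Data.Nat.Properties as ℕ
open import Data.Nat.Properties using (<ᵇ⇒<; ≤⇒≤ᵇ)
open import Data.Fin using (Fin; zero; suc; toℕ; inject≤; fromℕ<)
open import Data.Fin.Properties using (toℕ-injective; toℕ-inject≤; toℕ-fromℕ<; toℕ<n; any?)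
open import Data.Fin.Subset using (Subset; _∈_; _∉_; _⊆_; _∪_; ⁅_⁆; ⊥; ∣_∣)
open import Data.Fin.Subset.Properties
  using (x∈p∪q⁻; p⊆p∪q; q⊆p∪q; ∣q∣≤∣p∪q∣; x∈⁅x⁆; x∈⁅y⁆⇒x≡y; ∣⁅x⁆∣≡1; ∉⊥; ∣⊥∣≡0;
         ⊆-refl; ⊆-antisym; ⊥⊆; s⊆s; out⊆; in⊆in;
         ∪-identityˡ; ∪-identityʳ; drop-there; _∈?_; anySubset?)
open import Data.Vec using ([]; _∷_; here; there)
open import Data.Vec.Properties using (tabulate-cong; tabulate∘lookup; lookup-replicate)
open import Data.Integer as ℤ using (ℤ; +_; -_; 0ℤ)
import Data.Integer.Properties as ℤ
open import Algebra.Properties.CommutativeSemigroup ℤ.+-commutativeSemigroup using (interchange)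
open import Data.List using (List; []; _∷_; [_]; _++_; map; filter; length; applyUpTo)
import Data.List.Properties as List
open import Data.Nat.Combinatorics using (_C_; nCn≡1)
open import Data.Product using (∃; _×_; _,_; proj₁; proj₂)
open import Data.Sum as Sum using (_⊎_; inj₁; inj₂)
open import Data.Empty using (⊥-elim)
open import Function using (_∘_; id)
open import Relation.Nullary using (¬_; Dec; yes; no; ¬?; decidable-stable)
open import Relation.Nullary.Decidable using (_×-dec_)
open import Relation.Unary using (Decidable)
open import Relation.Binary.PropositionalEquality hiding ([_])

∣p∪q∣≡∣p∣+∣q∣ : ∀ {m} (p q : Subset m) → (∀ {x} → x ∈ p → x ∉ q) → ∣ p ∪ q ∣ ≡ ∣ p ∣ ℕ.+ ∣ q ∣
∣p∪q∣≡∣p∣+∣q∣ []          []          _ = refl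
∣p∪q∣≡∣p∣+∣q∣ (true ∷ p)  (true ∷ q)  disj = ⊥-elim (disj here here)
∣p∪q∣≡∣p∣+∣q∣ (true ∷ p)  (false ∷ q) disj = cong suc (∣p∪q∣≡∣p∣+∣q∣ p q λ x∈p x∈q → disj (there x∈p) (there x∈q))
∣p∪q∣≡∣p∣+∣q∣ (false ∷ p) (true ∷ q)  disj =
  trans (cong suc (∣p∪q∣≡∣p∣+∣q∣ p q λ x∈p x∈q → disj (there x∈p) (there x∈q))) (sym (ℕ.+-suc ∣ p ∣ ∣ q ∣))
∣p∪q∣≡∣p∣+∣q∣ (false ∷ p) (false ∷ q) disj = ∣p∪q∣≡∣p∣+∣q∣ p q λ x∈p x∈q → disj (there x∈p) (there x∈q)

x∉p⇒∣p∪⁅x⁆∣≡1+∣p∣ : ∀ {m} (p : Subset m) {x} → x ∉ p → ∣ p ∪ ⁅ x ⁆ ∣ ≡ suc ∣ p ∣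
x∉p⇒∣p∪⁅x⁆∣≡1+∣p∣ p {x} x∉p = begin
  ∣ p ∪ ⁅ x ⁆ ∣          ≡⟨ ∣p∪q∣≡∣p∣+∣q∣ p ⁅ x ⁆ (λ y∈p y∈⁅x⁆ → x∉p (subst (_∈ p) (x∈⁅y⁆⇒x≡y x y∈⁅x⁆) y∈p)) ⟩
  ∣ p ∣ ℕ.+ ∣ ⁅ x ⁆ ∣    ≡⟨ cong (∣ p ∣ ℕ.+_) (∣⁅x⁆∣≡1 x) ⟩
  ∣ p ∣ ℕ.+ 1            ≡⟨ ℕ.+-comm ∣ p ∣ 1 ⟩
  suc ∣ p ∣              ∎
  where open ≡-Reasoning

zero∉false∷p : ∀ {m} {p : Subset m} → zero ∉ false ∷ p
zero∉false∷p ()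

⁅x⁆⊆p : ∀ {m} {p : Subset m} {x} → x ∈ p → ⁅ x ⁆ ⊆ p
⁅x⁆⊆p {x = x} x∈p y∈⁅x⁆ = subst (_∈ _) (sym (x∈⁅y⁆⇒x≡y x y∈⁅x⁆)) x∈p

∪-least : ∀ {m} {p q r : Subset m} → p ⊆ r → q ⊆ r → p ∪ q ⊆ r
∪-least {p = p} {q} p⊆r q⊆r x∈p∪q with x∈p∪q⁻ p q x∈p∪q
... | inj₁ x∈p = p⊆r x∈p
... | inj₂ x∈q = q⊆r x∈q

∪-monoˡ-⊆ : ∀ {m} {p q : Subset m} (r : Subset m) → p ⊆ q → p ∪ r ⊆ q ∪ r
∪-monoˡ-⊆ {q = q} r p⊆q = ∪-least (p⊆p∪q r ∘ p⊆q) (q⊆p∪q q r)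

-- Independence systems

record IndependenceSystem (m : ℕ) : Set₁ where
  field
    Indep   : Subset m → Set
    indep?  : Decidable Indep
    indep-⊆ : ∀ {A B} → A ⊆ B → Indep B → Indep A

open IndependenceSystem public

module _ {m : ℕ} (M : IndependenceSystem m) where

  Augmentation : Set
  Augmentation = ∀ {A B} → Indep M A → Indep M B → ∣ A ∣ < ∣ B ∣ →
                 ∃ λ x → x ∈ B × x ∉ A × Indep M (A ∪ ⁅ x ⁆)

  RankAtMost : ℕ → Set
  RankAtMost r = ∀ S → Indep M S → ∣ S ∣ ≤ r

  HasIndepOfSize : ℕ → Set
  HasIndepOfSize r = ∃ λ S → Indep M S × ∣ S ∣ ≡ r

  IsColoop : Fin m → Set
  IsColoop e = ∀ S → Indep M S → Indep M (S ∪ ⁅ e ⁆)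

  augment-to : Augmentation → ∀ {A B} k → Indep M A → Indep M B → ∣ A ∣ ≤ k → k ≤ ∣ B ∣ →
               ∃ λ T → Indep M T × A ⊆ T × T ⊆ A ∪ B × ∣ T ∣ ≡ k
  augment-to augment {A} {B} k indA indB A≤k k≤B =
    subst (λ k → ∃ λ T → Indep M T × A ⊆ T × T ⊆ A ∪ B × ∣ T ∣ ≡ k) (ℕ.m∸n+n≡m A≤k)
      (go (k ∸ ∣ A ∣) indA (subst (_≤ ∣ B ∣) (sym (ℕ.m∸n+n≡m A≤k)) k≤B))
    where
    go : ∀ t {A} → Indep M A → t ℕ.+ ∣ A ∣ ≤ ∣ B ∣ →
         ∃ λ T → Indep M T × A ⊆ T × T ⊆ A ∪ B × ∣ T ∣ ≡ t ℕ.+ ∣ A ∣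
    go zero    {A} indA _ = A , indA , ⊆-refl , p⊆p∪q B , refl
    go (suc t) {A} indA t+A<B with augment indA indB (ℕ.<-≤-trans (s≤s (ℕ.m≤n+m ∣ A ∣ t)) t+A<B)
    ... | x , x∈B , x∉A , indAx =
      let T , indT , Ax⊆T , T⊆AxB , ∣T∣ = go t indAx (subst (_≤ ∣ B ∣) (sym size) t+A<B)
      in  T , indT , Ax⊆T ∘ p⊆p∪q ⁅ x ⁆ ,
          ∪-least (∪-least (p⊆p∪q B) (⁅x⁆⊆p (q⊆p∪q A B x∈B))) (q⊆p∪q A B) ∘ T⊆AxB ,
          trans ∣T∣ size
      where
      size : t ℕ.+ ∣ A ∪ ⁅ x ⁆ ∣ ≡ suc t ℕ.+ ∣ A ∣
      size = trans (cong (t ℕ.+_) (x∉p⇒∣p∪⁅x⁆∣≡1+∣p∣ A x∉A)) (ℕ.+-suc t ∣ A ∣)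

delete₀ : ∀ {m} → IndependenceSystem (suc m) → IndependenceSystem m
delete₀ M = record { Indep = Indep M ∘ (false ∷_) ; indep? = indep? M ∘ (false ∷_) ; indep-⊆ = indep-⊆ M ∘ s⊆s }

contract₀ : ∀ {m} → IndependenceSystem (suc m) → IndependenceSystem m
contract₀ M = record { Indep = Indep M ∘ (true ∷_) ; indep? = indep? M ∘ (true ∷_) ; indep-⊆ = indep-⊆ M ∘ s⊆s }

module _ {m : ℕ} (M : IndependenceSystem (suc m)) where

  augmentation-delete₀ : Augmentation M → Augmentation (delete₀ M)
  augmentation-delete₀ augment indA indB A<B with augment indA indB A<B
  ... | zero  , ()        , _   , _
  ... | suc x , there x∈B , x∉A , indAx = x , x∈B , x∉A ∘ there , indAx

  augmentation-contract₀ : Augmentation M → Augmentation (contract₀ M)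
  augmentation-contract₀ augment indA indB A<B with augment indA indB (s≤s A<B)
  ... | zero  , _         , 0∉A , _     = ⊥-elim (0∉A here)
  ... | suc x , there x∈B , x∉A , indAx = x , x∈B , x∉A ∘ there , indAx

-- Signed counts of independent sets

when : ∀ {A : Set} → Dec A → ℤ → ℤ
when (yes _) z = z
when (no _)  _ = 0ℤ

-- indepSum M w is the sum of w ∣ S ∣ over the independent sets S of M.
indepSum : ∀ {m} → IndependenceSystem m → (ℕ → ℤ) → ℤ
indepSum {zero}  M w = when (indep? M []) (w 0)
indepSum {suc m} M w = indepSum (delete₀ M) w ℤ.+ indepSum (contract₀ M) (w ∘ suc)

signedCount : ∀ {m} → IndependenceSystem m → ℕ → ℤ
signedCount M r = indepSum M λ k → sign (r ∸ k)

indepSum-cong : ∀ {m} (M N : IndependenceSystem m) {v w : ℕ → ℤ} →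
                (∀ {S} → Indep M S → Indep N S) → (∀ {S} → Indep N S → Indep M S) →
                (∀ {S} → Indep M S → v ∣ S ∣ ≡ w ∣ S ∣) → indepSum M v ≡ indepSum N w
indepSum-cong {zero} M N M⇒N N⇒M v≡w with indep? M [] | indep? N []
... | yes indM | yes _    = v≡w indM
... | yes indM | no ¬indN = ⊥-elim (¬indN (M⇒N indM))
... | no ¬indM | yes indN = ⊥-elim (¬indM (N⇒M indN))
... | no _     | no _     = refl
indepSum-cong {suc m} M N M⇒N N⇒M v≡w =
  cong₂ ℤ._+_ (indepSum-cong (delete₀ M) (delete₀ N) M⇒N N⇒M v≡w)
              (indepSum-cong (contract₀ M) (contract₀ N) M⇒N N⇒M v≡w)

indepSum-neg : ∀ {m} (M : IndependenceSystem m) (w : ℕ → ℤ) → indepSum M (-_ ∘ w) ≡ - indepSum M w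
indepSum-neg {zero} M w with indep? M []
... | yes _ = refl
... | no _  = refl
indepSum-neg {suc m} M w = begin
  indepSum (delete₀ M) (-_ ∘ w) ℤ.+ indepSum (contract₀ M) (-_ ∘ w ∘ suc)
    ≡⟨ cong₂ ℤ._+_ (indepSum-neg (delete₀ M) w) (indepSum-neg (contract₀ M) (w ∘ suc)) ⟩
  - indepSum (delete₀ M) w ℤ.+ - indepSum (contract₀ M) (w ∘ suc)
    ≡⟨ ℤ.neg-distrib-+ (indepSum (delete₀ M) w) _ ⟨
  - indepSum M w ∎
  where open ≡-Reasoning

indepSum-empty : ∀ {m} (M : IndependenceSystem m) (w : ℕ → ℤ) → (∀ S → ¬ Indep M S) → indepSum M w ≡ 0ℤ
indepSum-empty {zero} M w none with indep? M []
... | yes ind = ⊥-elim (none [] ind)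
... | no _    = refl
indepSum-empty {suc m} M w none =
  cong₂ ℤ._+_ (indepSum-empty (delete₀ M) w (none ∘ (false ∷_)))
              (indepSum-empty (contract₀ M) (w ∘ suc) (none ∘ (true ∷_)))

sign-suc : ∀ k → sign (suc k) ≡ - sign k
sign-suc zero          = refl
sign-suc (suc zero)    = refl
sign-suc (suc (suc k)) = sign-suc k

-- A coloop pairs each independent set S ∌ e with S ∪ ⁅ e ⁆, and the two carry opposite signs.
signedCount-coloop : ∀ {m} (M : IndependenceSystem m) r → RankAtMost M r → ∀ e → IsColoop M e →
                     signedCount M r ≡ 0ℤ
signedCount-coloop M zero rank e coloop = indepSum-empty M _ λ S indS →
  ℕ.n≮0 (ℕ.≤-trans (subst (_≤ ∣ S ∪ ⁅ e ⁆ ∣) (∣⁅x⁆∣≡1 e) (∣q∣≤∣p∪q∣ S ⁅ e ⁆)) (rank _ (coloop S indS)))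
signedCount-coloop {suc m} M (suc r) rank zero coloop = begin
  indepSum (delete₀ M) (λ k → sign (suc r ∸ k)) ℤ.+ signedCount (contract₀ M) r
    ≡⟨ cong (ℤ._+ signedCount (contract₀ M) r) deletion≡-contraction ⟩
  - signedCount (contract₀ M) r ℤ.+ signedCount (contract₀ M) r
    ≡⟨ ℤ.+-inverseˡ (signedCount (contract₀ M) r) ⟩
  0ℤ ∎
  where
  open ≡-Reasoning
  delete⇒contract : ∀ {S} → Indep M (false ∷ S) → Indep M (true ∷ S)
  delete⇒contract {S} ind = subst (Indep M ∘ (true ∷_)) (∪-identityʳ S) (coloop _ ind)
  deletion≡-contraction : indepSum (delete₀ M) (λ k → sign (suc r ∸ k)) ≡ - signedCount (contract₀ M) r
  deletion≡-contraction = trans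
    (indepSum-cong (delete₀ M) (contract₀ M) delete⇒contract (indep-⊆ M (out⊆ ⊆-refl))
      λ {S} ind → trans (cong sign (ℕ.+-∸-assoc 1 (s≤s⁻¹ (rank _ (delete⇒contract ind))))) (sign-suc (r ∸ ∣ S ∣)))
    (indepSum-neg (contract₀ M) _)
signedCount-coloop {suc m} M (suc r) rank (suc e) coloop =
  cong₂ ℤ._+_ (signedCount-coloop (delete₀ M) (suc r) (λ S → rank _) e (λ S → coloop _))
              (signedCount-coloop (contract₀ M) r (λ S → s≤s⁻¹ ∘ rank _) e (λ S → coloop _))

module _ {m : ℕ} (M : IndependenceSystem (suc m)) where

  contract₀-empty : ¬ Indep M ⁅ zero ⁆ → ∀ S → ¬ Indep (contract₀ M) S
  contract₀-empty ¬ind₀ S ind = ¬ind₀ (indep-⊆ M (in⊆in ⊥⊆) ind)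

  coloop-delete₀⇒coloop : ¬ Indep M ⁅ zero ⁆ → ∀ {f} → IsColoop (delete₀ M) f → IsColoop M (suc f)
  coloop-delete₀⇒coloop ¬ind₀ coloop (false ∷ S) ind = coloop S ind
  coloop-delete₀⇒coloop ¬ind₀ coloop (true ∷ S)  ind = ⊥-elim (contract₀-empty ¬ind₀ S ind)

  delete₀-hasIndepOfSize : Augmentation M → ∀ {S₀ S r} → Indep M S₀ → ¬ Indep M (S₀ ∪ ⁅ zero ⁆) →
                           Indep M S → ∣ S₀ ∣ ≤ r → r ≤ ∣ S ∣ → HasIndepOfSize (delete₀ M) r
  delete₀-hasIndepOfSize augment {r = r} indS₀ ¬indS₀₀ indS S₀≤r r≤S
    with augment-to M augment r indS₀ indS S₀≤r r≤S
  ... | true  ∷ T , indT , S₀⊆T , _ , _   = ⊥-elim (¬indS₀₀ (indep-⊆ M (∪-least S₀⊆T (⁅x⁆⊆p here)) indT))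
  ... | false ∷ T , indT , _    , _ , ∣T∣ = T , indT , ∣T∣

  contract₀-hasIndepOfSize : Augmentation M → Indep M ⁅ zero ⁆ → ∀ {S r} → Indep M S → suc r ≤ ∣ S ∣ →
                             HasIndepOfSize (contract₀ M) r
  contract₀-hasIndepOfSize augment ind₀ {r = r} indS r<S
    with augment-to M augment (suc r) ind₀ indS (subst (_≤ suc r) (sym (∣⁅x⁆∣≡1 {n = suc m} zero)) (s≤s z≤n)) r<S
  ... | false ∷ T , _    , ⁅0⁆⊆T , _ , _   = ⊥-elim (zero∉false∷p (⁅0⁆⊆T here))
  ... | true  ∷ T , indT , _     , _ , ∣T∣ = T , indT , ℕ.suc-injective ∣T∣

  module _ (augment : Augmentation M) (ind₀ : Indep M ⁅ zero ⁆) {f} (coloop : IsColoop (contract₀ M) f)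
           {S} (indS : Indep M (false ∷ S)) where

    larger-through-zero : f ∉ S → ∃ λ D → Indep M D × D ⊆ true ∷ (S ∪ ⁅ f ⁆) × ∣ S ∣ < ∣ D ∣
    larger-through-zero f∉S with 0 <? ∣ S ∣
    ... | no S≯0 = ⁅ zero ⁆ , ind₀ , in⊆in ⊥⊆ , s≤s (ℕ.≤-trans (ℕ.≮⇒≥ S≯0) z≤n)
    ... | yes S>0
      with augment-to M augment ∣ S ∣ ind₀ indS (subst (_≤ ∣ S ∣) (sym (∣⁅x⁆∣≡1 {n = suc m} zero)) S>0) ℕ.≤-refl
    ...   | false ∷ T , _    , ⁅0⁆⊆T , _    , _   = ⊥-elim (zero∉false∷p (⁅0⁆⊆T here))
    ...   | true  ∷ T , indT , _     , T⊆0S , ∣T∣ =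
      true ∷ (T ∪ ⁅ f ⁆) , coloop T indT , s⊆s (∪-monoˡ-⊆ ⁅ f ⁆ T⊆S) ,
      ℕ.≤-reflexive (cong suc (sym (trans (x∉p⇒∣p∪⁅x⁆∣≡1+∣p∣ T (f∉S ∘ T⊆S)) ∣T∣)))
      where
      T⊆S : T ⊆ S
      T⊆S x∈T = subst (_ ∈_) (∪-identityˡ S) (drop-there (T⊆0S (there x∈T)))

    -- Exchanging S against a larger independent set through 0: the only element it can contribute is f.
    extend-by-contraction-coloop : ¬ Indep M (true ∷ S) → Indep M (false ∷ (S ∪ ⁅ f ⁆))
    extend-by-contraction-coloop ¬indS₀ with f ∈? S
    ... | yes f∈S = indep-⊆ M (s⊆s (∪-least ⊆-refl (⁅x⁆⊆p f∈S))) indS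
    ... | no f∉S with larger-through-zero f∉S
    ...   | D , indD , D⊆ , S<D with augment indS indD S<D
    ...     | zero  , _     , _   , indS₀ = ⊥-elim (¬indS₀ (subst (Indep M ∘ (true ∷_)) (∪-identityʳ S) indS₀))
    ...     | suc y , y∈D , y∉S , indSy with x∈p∪q⁻ S ⁅ f ⁆ (drop-there (D⊆ y∈D))
    ...       | inj₁ y∈S   = ⊥-elim (y∉S (there y∈S))
    ...       | inj₂ y∈⁅f⁆ = subst (λ y → Indep M (false ∷ (S ∪ ⁅ y ⁆))) (x∈⁅y⁆⇒x≡y f y∈⁅f⁆) indSy

  coloop-contract₀⇒coloop : Augmentation M → Indep M ⁅ zero ⁆ → ∀ {f} → IsColoop (contract₀ M) f → IsColoop M (suc f)
  coloop-contract₀⇒coloop augment ind₀ coloop (true ∷ S) ind = coloop S ind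
  coloop-contract₀⇒coloop augment ind₀ coloop (false ∷ S) ind with indep? M (true ∷ S)
  ... | yes indS₀ = indep-⊆ M (out⊆ ⊆-refl) (coloop S indS₀)
  ... | no ¬indS₀ = extend-by-contraction-coloop augment ind₀ coloop ind ¬indS₀

module _ {m : ℕ} (M : IndependenceSystem m) where

  PositiveOrColoop : ℕ → Set
  PositiveOrColoop r = 0ℤ ℤ.< signedCount M r ⊎ ∃ (IsColoop M)

  positiveOrColoop⇒nonneg : ∀ {r} → RankAtMost M r → PositiveOrColoop r → 0ℤ ℤ.≤ signedCount M r
  positiveOrColoop⇒nonneg rank (inj₁ pos)          = ℤ.<⇒≤ pos
  positiveOrColoop⇒nonneg rank (inj₂ (e , coloop)) = ℤ.≤-reflexive (sym (signedCount-coloop M _ rank e coloop))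

module _ {m : ℕ} (M : IndependenceSystem (suc m)) where

  positiveOrColoop-loop : ¬ Indep M ⁅ zero ⁆ → ∀ {r} → PositiveOrColoop (delete₀ M) r → PositiveOrColoop M r
  positiveOrColoop-loop ¬ind₀ {r} (inj₁ pos) = inj₁ (subst (0ℤ ℤ.<_) (sym signedCount≡) pos)
    where
    signedCount≡ : signedCount M r ≡ signedCount (delete₀ M) r
    signedCount≡ = trans (cong (ℤ._+_ (signedCount (delete₀ M) r))
                                (indepSum-empty (contract₀ M) _ (contract₀-empty M ¬ind₀)))
                         (ℤ.+-identityʳ _)
  positiveOrColoop-loop ¬ind₀ (inj₂ (f , coloop)) = inj₂ (suc f , coloop-delete₀⇒coloop M ¬ind₀ coloop)

  positiveOrColoop-nonloop : Augmentation M → Indep M ⁅ zero ⁆ → ∀ {r} → RankAtMost M (suc r) →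
                             PositiveOrColoop (delete₀ M) (suc r) → PositiveOrColoop (contract₀ M) r →
                             PositiveOrColoop M (suc r)
  positiveOrColoop-nonloop augment ind₀ rank deletion (inj₁ pos) =
    inj₁ (ℤ.+-mono-≤-< (positiveOrColoop⇒nonneg (delete₀ M) (λ _ → rank _) deletion) pos)
  positiveOrColoop-nonloop augment ind₀ rank deletion (inj₂ (f , coloop)) =
    inj₂ (suc f , coloop-contract₀⇒coloop M augment ind₀ coloop)

-- Deletion–contraction at the element 0: a loop contributes nothing, a coloop is a witness,
-- and otherwise both minors have full rank and their signed counts add up.
signedCount-positiveOrColoop : ∀ {m} (M : IndependenceSystem m) → Augmentation M → ∀ r →
                               RankAtMost M r → HasIndepOfSize M r → PositiveOrColoop M r
signedCount-positiveOrColoop {zero} M augment r rank ([] , ind , refl) with indep? M []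
... | yes _   = inj₁ (ℤ.+<+ (s≤s z≤n))
... | no ¬ind = ⊥-elim (¬ind ind)
signedCount-positiveOrColoop {suc m} M augment r rank (S , indS , ∣S∣≡r) with indep? M ⁅ zero ⁆
... | no ¬ind₀ = positiveOrColoop-loop M ¬ind₀
  (signedCount-positiveOrColoop (delete₀ M) (augmentation-delete₀ M augment) r (λ _ → rank _)
    (subst (HasIndepOfSize (delete₀ M)) ∣S∣≡r (avoiding₀ S indS)))
  where
  avoiding₀ : ∀ S → Indep M S → HasIndepOfSize (delete₀ M) ∣ S ∣
  avoiding₀ (false ∷ S) ind = S , ind , refl
  avoiding₀ (true  ∷ S) ind = ⊥-elim (contract₀-empty M ¬ind₀ S ind)
... | yes ind₀ with anySubset? (λ S₀ → indep? M S₀ ×-dec ¬? (indep? M (S₀ ∪ ⁅ zero ⁆)))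
...   | no noBlocker = inj₂ (zero , λ S₀ indS₀ → decidable-stable (indep? M _) λ ¬ind → noBlocker (S₀ , indS₀ , ¬ind))
signedCount-positiveOrColoop {suc m} M augment zero rank _ | yes ind₀ | yes _ = ⊥-elim (ℕ.n≮0 (rank _ ind₀))
signedCount-positiveOrColoop {suc m} M augment (suc r) rank (S , indS , ∣S∣≡r)
  | yes ind₀ | yes (S₀ , indS₀ , ¬indS₀₀) =
  positiveOrColoop-nonloop M augment ind₀ rank
    (signedCount-positiveOrColoop (delete₀ M) (augmentation-delete₀ M augment) (suc r) (λ _ → rank _)
      (delete₀-hasIndepOfSize M augment indS₀ ¬indS₀₀ indS (rank _ indS₀) (ℕ.≤-reflexive (sym ∣S∣≡r))))
    (signedCount-positiveOrColoop (contract₀ M) (augmentation-contract₀ M augment) r (λ _ → s≤s⁻¹ ∘ rank _)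
      (contract₀-hasIndepOfSize M augment ind₀ indS (ℕ.≤-reflexive (sym ∣S∣≡r))))

-- The top h-number as a signed count

sumUpTo : ℕ → (ℕ → ℤ) → ℤ
sumUpTo n f = sumℤ (applyUpTo f n)

sumUpTo-cong : ∀ n {f g : ℕ → ℤ} → (∀ i → f i ≡ g i) → sumUpTo n f ≡ sumUpTo n g
sumUpTo-cong zero    f≗g = refl
sumUpTo-cong (suc n) f≗g = cong₂ ℤ._+_ (f≗g 0) (sumUpTo-cong n (f≗g ∘ suc))

sumUpTo-+ : ∀ n (f g : ℕ → ℤ) → sumUpTo n (λ i → f i ℤ.+ g i) ≡ sumUpTo n f ℤ.+ sumUpTo n g
sumUpTo-+ zero    f g = refl
sumUpTo-+ (suc n) f g =
  trans (cong (ℤ._+_ (f 0 ℤ.+ g 0)) (sumUpTo-+ n (f ∘ suc) (g ∘ suc))) (interchange (f 0) (g 0) _ _)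

sumUpTo-zero : ∀ n {f : ℕ → ℤ} → (∀ i → f i ≡ 0ℤ) → sumUpTo n f ≡ 0ℤ
sumUpTo-zero zero    f≗0 = refl
sumUpTo-zero (suc n) f≗0 = cong₂ ℤ._+_ (f≗0 0) (sumUpTo-zero n (f≗0 ∘ suc))

sumUpTo-select : ∀ n (f : ℕ → ℤ) {k} → k < n → (∀ i → i ≢ k → f i ≡ 0ℤ) → sumUpTo n f ≡ f k
sumUpTo-select (suc n) f {zero} _ f≗0 =
  trans (cong (ℤ._+_ (f 0)) (sumUpTo-zero n λ i → f≗0 (suc i) λ ())) (ℤ.+-identityʳ (f 0))
sumUpTo-select (suc n) f {suc k} k<n f≗0 =
  trans (cong₂ ℤ._+_ (f≗0 0 λ ())
                     (sumUpTo-select n (f ∘ suc) (s≤s⁻¹ k<n) λ i i≢k → f≗0 (suc i) (i≢k ∘ ℕ.suc-injective)))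
        (ℤ.+-identityˡ (f (suc k)))

sumWhen : ∀ {A : Set} {P : A → Set} → Decidable P → (A → ℤ) → List A → ℤ
sumWhen P? w []       = 0ℤ
sumWhen P? w (x ∷ xs) = when (P? x) (w x) ℤ.+ sumWhen P? w xs

sumWhen-++ : ∀ {A : Set} {P : A → Set} (P? : Decidable P) (w : A → ℤ) xs ys →
             sumWhen P? w (xs ++ ys) ≡ sumWhen P? w xs ℤ.+ sumWhen P? w ys
sumWhen-++ P? w []       ys = sym (ℤ.+-identityˡ _)
sumWhen-++ P? w (x ∷ xs) ys =
  trans (cong (ℤ._+_ (when (P? x) (w x))) (sumWhen-++ P? w xs ys)) (sym (ℤ.+-assoc (when (P? x) (w x)) _ _))

sumWhen-map : ∀ {A B : Set} {P : B → Set} (P? : Decidable P) (w : B → ℤ) (f : A → B) xs →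
              sumWhen P? w (map f xs) ≡ sumWhen (P? ∘ f) (w ∘ f) xs
sumWhen-map P? w f []       = refl
sumWhen-map P? w f (x ∷ xs) = cong (ℤ._+_ (when (P? (f x)) (w (f x)))) (sumWhen-map P? w f xs)

indepSum≡sumWhen : ∀ {m} (M : IndependenceSystem m) (w : ℕ → ℤ) →
                   indepSum M w ≡ sumWhen (indep? M) (w ∘ ∣_∣) (allSubsets m)
indepSum≡sumWhen {zero}  M w = sym (ℤ.+-identityʳ _)
indepSum≡sumWhen {suc m} M w = sym (begin
  sumWhen (indep? M) (w ∘ ∣_∣) (map (false ∷_) (allSubsets m) ++ map (true ∷_) (allSubsets m))
    ≡⟨ sumWhen-++ (indep? M) (w ∘ ∣_∣) (map (false ∷_) (allSubsets m)) _ ⟩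
  sumWhen (indep? M) (w ∘ ∣_∣) (map (false ∷_) (allSubsets m)) ℤ.+
  sumWhen (indep? M) (w ∘ ∣_∣) (map (true ∷_) (allSubsets m))
    ≡⟨ cong₂ ℤ._+_ (sumWhen-map (indep? M) (w ∘ ∣_∣) (false ∷_) (allSubsets m))
                   (sumWhen-map (indep? M) (w ∘ ∣_∣) (true ∷_) (allSubsets m)) ⟩
  sumWhen (indep? (delete₀ M)) (w ∘ ∣_∣) (allSubsets m) ℤ.+
  sumWhen (indep? (contract₀ M)) (w ∘ suc ∘ ∣_∣) (allSubsets m)
    ≡⟨ cong₂ ℤ._+_ (indepSum≡sumWhen (delete₀ M) w) (indepSum≡sumWhen (contract₀ M) (w ∘ suc)) ⟨
  indepSum M w ∎)
  where open ≡-Reasoning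

module _ {m} {P : Subset m → Set} (P? : Decidable P) (D : ∀ i → Decidable (λ S → P S × ∣ S ∣ ≡ i)) (r : ℕ) where

  signedTerm : List (Subset m) → ℕ → ℤ
  signedTerm L i = sign (r ∸ i) ℤ.* + length (filter (D i) L)

  signedTerms : List (Subset m) → ℤ
  signedTerms L = sumUpTo (suc r) (signedTerm L)

  signedTerm-∷ : ∀ S L i → signedTerm (S ∷ L) i ≡ signedTerm [ S ] i ℤ.+ signedTerm L i
  signedTerm-∷ S L i = begin
    sign (r ∸ i) ℤ.* + length (filter (D i) (S ∷ L))
      ≡⟨ cong (λ n → sign (r ∸ i) ℤ.* + n)
           (trans (cong length (List.filter-++ (D i) [ S ] L)) (List.length-++ (filter (D i) [ S ]))) ⟩
    sign (r ∸ i) ℤ.* (+ length (filter (D i) [ S ]) ℤ.+ + length (filter (D i) L))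
      ≡⟨ ℤ.*-distribˡ-+ (sign (r ∸ i)) _ _ ⟩
    signedTerm [ S ] i ℤ.+ signedTerm L i ∎
    where open ≡-Reasoning

  signedTerm-reject : ∀ {S} L i → ¬ (P S × ∣ S ∣ ≡ i) → signedTerm (S ∷ L) i ≡ signedTerm L i
  signedTerm-reject L i ¬q = cong (λ L → sign (r ∸ i) ℤ.* + length L) (List.filter-reject (D i) ¬q)

  signedTerms-[_] : ∀ S → (P S → ∣ S ∣ ≤ r) → signedTerms [ S ] ≡ when (P? S) (sign (r ∸ ∣ S ∣))
  signedTerms-[ S ] S≤r with P? S
  ... | no ¬p = sumUpTo-zero (suc r) λ i → trans (signedTerm-reject {S} [] i (¬p ∘ proj₁)) (ℤ.*-zeroʳ (sign (r ∸ i)))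
  ... | yes p = begin
    sumUpTo (suc r) (signedTerm [ S ])
      ≡⟨ sumUpTo-select (suc r) (signedTerm [ S ]) (s≤s (S≤r p))
           (λ i i≢∣S∣ → trans (signedTerm-reject {S} [] i (i≢∣S∣ ∘ sym ∘ proj₂)) (ℤ.*-zeroʳ (sign (r ∸ i)))) ⟩
    signedTerm [ S ] ∣ S ∣
      ≡⟨ cong (λ L → sign (r ∸ ∣ S ∣) ℤ.* + length L) (List.filter-accept (D ∣ S ∣) (p , refl)) ⟩
    sign (r ∸ ∣ S ∣) ℤ.* + 1
      ≡⟨ ℤ.*-identityʳ _ ⟩
    sign (r ∸ ∣ S ∣) ∎
    where open ≡-Reasoning

  signedTerms≡sumWhen : (∀ S → P S → ∣ S ∣ ≤ r) → ∀ L → signedTerms L ≡ sumWhen P? (λ S → sign (r ∸ ∣ S ∣)) L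
  signedTerms≡sumWhen rank []      = sumUpTo-zero (suc r) λ i → ℤ.*-zeroʳ (sign (r ∸ i))
  signedTerms≡sumWhen rank (S ∷ L) = begin
    signedTerms (S ∷ L)
      ≡⟨ sumUpTo-cong (suc r) (signedTerm-∷ S L) ⟩
    sumUpTo (suc r) (λ i → signedTerm [ S ] i ℤ.+ signedTerm L i)
      ≡⟨ sumUpTo-+ (suc r) (signedTerm [ S ]) (signedTerm L) ⟩
    signedTerms [ S ] ℤ.+ signedTerms L
      ≡⟨ cong₂ ℤ._+_ (signedTerms-[ S ] (rank S)) (signedTerms≡sumWhen rank L) ⟩
    sumWhen P? (λ S → sign (r ∸ ∣ S ∣)) (S ∷ L) ∎
    where open ≡-Reasoning

fCount≡length-filter : ∀ {m} {P : Subset m → Set} (P? : Decidable P) (D : ∀ i → Decidable (λ S → P S × ∣ S ∣ ≡ i)) i →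
                       fCount P P? i ≡ length (filter (D i) (allSubsets m))
fCount≡length-filter P? D i = cong length (List.filter-≐ _ (D i) (id , id) (allSubsets _))

-- At the top degree every binomial coefficient (r ∸ i) C (r ∸ i) is 1.
hEntry-top≡signedCount : ∀ {m} (M : IndependenceSystem m) r → RankAtMost M r →
                         hEntry r (fCount (Indep M) (indep? M)) r ≡ signedCount M r
hEntry-top≡signedCount {m} M r rank = begin
  hEntry r f r
    ≡⟨ cong sumℤ (List.map-applyUpTo id (λ i → sign (r ∸ i) ℤ.* + ((r ∸ i) C (r ∸ i)) ℤ.* + f i) (suc r)) ⟩
  sumUpTo (suc r) (λ i → sign (r ∸ i) ℤ.* + ((r ∸ i) C (r ∸ i)) ℤ.* + f i)
    ≡⟨ sumUpTo-cong (suc r) (λ i → cong (λ c → sign (r ∸ i) ℤ.* + c ℤ.* + f i) (nCn≡1 (r ∸ i))) ⟩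
  sumUpTo (suc r) (λ i → sign (r ∸ i) ℤ.* + 1 ℤ.* + f i)
    ≡⟨ sumUpTo-cong (suc r) (λ i → cong (ℤ._* + f i) (ℤ.*-identityʳ (sign (r ∸ i)))) ⟩
  sumUpTo (suc r) (λ i → sign (r ∸ i) ℤ.* + f i)
    ≡⟨ sumUpTo-cong (suc r) (λ i → cong (λ n → sign (r ∸ i) ℤ.* + n) (fCount≡length-filter (indep? M) D i)) ⟩
  signedTerms (indep? M) D r (allSubsets m)
    ≡⟨ signedTerms≡sumWhen (indep? M) D r rank (allSubsets m) ⟩
  sumWhen (indep? M) (λ S → sign (r ∸ ∣ S ∣)) (allSubsets m)
    ≡⟨ indepSum≡sumWhen M (λ k → sign (r ∸ k)) ⟨
  signedCount M r ∎
  where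
  open ≡-Reasoning
  f = fCount (Indep M) (indep? M)
  D : ∀ i → Decidable (λ S → Indep M S × ∣ S ∣ ≡ i)
  D i S = indep? M S ×-dec (∣ S ∣ ℕ.≟ i)

-- The embedding of [d] into [n]

embed-zero : ∀ {n} (G : Subset 0) → embed {n} G ≡ ⊥
embed-zero _ = trans (tabulate-cong λ j → sym (lookup-replicate j false)) (tabulate∘lookup ⊥)

initSeg-zero : ∀ n → initSeg n 0 ≡ ⊥
initSeg-zero _ = trans (tabulate-cong λ j → sym (lookup-replicate j false)) (tabulate∘lookup ⊥)

-- Both sides test the same boolean toℕ j <ᵇ d; abstracting it together with the proofs
-- built from it makes them compute to the same value.
mutual
  embed-∷ : ∀ {n d} b (G : Subset d) → embed {suc n} (b ∷ G) ≡ b ∷ embed {n} G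
  embed-∷ {n} {d} b G = cong (b ∷_) (tabulate-cong (embed-∷-pointwise {n} {d} b G))

  embed-∷-pointwise : ∀ {n d} b (G : Subset d) (j : Fin n) → _
  embed-∷-pointwise {n} {d} b G j
    with toℕ j <ᵇ d | <ᵇ⇒< (toℕ j) d | ≤⇒≤ᵇ {suc (suc (toℕ j))} {suc d} | ≤⇒≤ᵇ {suc (toℕ j)} {d}
  ... | true  | _ | _ | _ = refl
  ... | false | _ | _ | _ = refl

mutual
  initSeg-suc : ∀ n d → initSeg (suc n) (suc d) ≡ true ∷ initSeg n d
  initSeg-suc n d = cong (true ∷_) (tabulate-cong (initSeg-suc-pointwise {n} d))

  initSeg-suc-pointwise : ∀ {n} d (j : Fin n) → _
  initSeg-suc-pointwise d j
    with toℕ j <ᵇ d | <ᵇ⇒< (toℕ j) d | ≤⇒≤ᵇ {suc (suc (toℕ j))} {suc d} | ≤⇒≤ᵇ {suc (toℕ j)} {d}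
  ... | true  | _ | _ | _ = refl
  ... | false | _ | _ | _ = refl

∈-embed⁺ : ∀ {n d} (d≤n : d ≤ n) (G : Subset d) {g} → g ∈ G → inject≤ g d≤n ∈ embed {n} G
∈-embed⁺ (s≤s d≤n) (b ∷ G)         here        = subst (zero ∈_) (sym (embed-∷ b G)) here
∈-embed⁺ (s≤s d≤n) (b ∷ G) {suc g} (there g∈G) =
  subst (suc (inject≤ g d≤n) ∈_) (sym (embed-∷ b G)) (there (∈-embed⁺ d≤n G g∈G))

∈-embed⁻ : ∀ {n d} (d≤n : d ≤ n) (G : Subset d) {j} → j ∈ embed {n} G → ∃ λ g → j ≡ inject≤ g d≤n × g ∈ G
∈-embed⁻ {n} z≤n G {j} j∈ = ⊥-elim (∉⊥ (subst (j ∈_) (embed-zero {n} G) j∈))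
∈-embed⁻ {suc n} (s≤s d≤n) (b ∷ G) {j} j∈ = cons b (subst (j ∈_) (embed-∷ {n} b G) j∈)
  where
  cons : ∀ b {j} → j ∈ b ∷ embed G → ∃ λ g → j ≡ inject≤ g (s≤s d≤n) × g ∈ b ∷ G
  cons .true here       = zero , refl , here
  cons b     (there j∈) = let g , j≡g , g∈G = ∈-embed⁻ d≤n G j∈ in suc g , cong suc j≡g , there g∈G

∣embed∣ : ∀ {n d} (d≤n : d ≤ n) (G : Subset d) → ∣ embed {n} G ∣ ≡ ∣ G ∣
∣embed∣ {n} z≤n       []              = trans (cong ∣_∣ (embed-zero {n} [])) (∣⊥∣≡0 n)
∣embed∣ {suc n} (s≤s d≤n) (true ∷ G)  = trans (cong ∣_∣ (embed-∷ {n} true G)) (cong suc (∣embed∣ d≤n G))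
∣embed∣ {suc n} (s≤s d≤n) (false ∷ G) = trans (cong ∣_∣ (embed-∷ {n} false G)) (∣embed∣ d≤n G)

∈-initSeg⁻ : ∀ {n d} (d≤n : d ≤ n) {j} → j ∈ initSeg n d → toℕ j < d
∈-initSeg⁻ {n} z≤n {j} j∈ = ⊥-elim (∉⊥ (subst (j ∈_) (initSeg-zero n) j∈))
∈-initSeg⁻ {suc n} {suc d} (s≤s d≤n) {j} j∈ = cons (subst (j ∈_) (initSeg-suc n d) j∈)
  where
  cons : ∀ {j} → j ∈ true ∷ initSeg n d → toℕ j < suc d
  cons here       = s≤s z≤n
  cons (there j∈) = s≤s (∈-initSeg⁻ d≤n j∈)

∈-initSeg⁺ : ∀ {n d} (d≤n : d ≤ n) {j} → toℕ j < d → j ∈ initSeg n d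
∈-initSeg⁺ {suc n} {suc d} (s≤s d≤n) {zero}  _         = subst (zero ∈_) (sym (initSeg-suc n d)) here
∈-initSeg⁺ {suc n} {suc d} (s≤s d≤n) {suc j} (s≤s j<d) =
  subst (suc j ∈_) (sym (initSeg-suc n d)) (there (∈-initSeg⁺ d≤n j<d))

∣initSeg∣ : ∀ {n d} → d ≤ n → ∣ initSeg n d ∣ ≡ d
∣initSeg∣ {n} z≤n = trans (cong ∣_∣ (initSeg-zero n)) (∣⊥∣≡0 n)
∣initSeg∣ {suc n} {suc d} (s≤s d≤n) = trans (cong ∣_∣ (initSeg-suc n d)) (cong suc (∣initSeg∣ d≤n))

restrict : ∀ {n d} → d ≤ n → Subset n → Subset d
restrict z≤n       _       = []
restrict (s≤s d≤n) (b ∷ T) = b ∷ restrict d≤n T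

∈-restrict⁺ : ∀ {n d} (d≤n : d ≤ n) (T : Subset n) {g} → inject≤ g d≤n ∈ T → g ∈ restrict d≤n T
∈-restrict⁺ (s≤s d≤n) (b ∷ T) {zero}  here      = here
∈-restrict⁺ (s≤s d≤n) (b ∷ T) {suc g} (there p) = there (∈-restrict⁺ d≤n T p)

∈-restrict⁻ : ∀ {n d} (d≤n : d ≤ n) (T : Subset n) {g} → g ∈ restrict d≤n T → inject≤ g d≤n ∈ T
∈-restrict⁻ (s≤s d≤n) (b ∷ T) here      = here
∈-restrict⁻ (s≤s d≤n) (b ∷ T) (there p) = there (∈-restrict⁻ d≤n T p)

toℕ<⇒inject≤ : ∀ {n d} (d≤n : d ≤ n) {j : Fin n} (j<d : toℕ j < d) → j ≡ inject≤ (fromℕ< j<d) d≤n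
toℕ<⇒inject≤ d≤n j<d = toℕ-injective (sym (trans (toℕ-inject≤ (fromℕ< j<d) d≤n) (toℕ-fromℕ< j<d)))

-- The matroid Γ_I

matroidSystem : ∀ {m} → Matroid m → IndependenceSystem m
matroidSystem Δ = record { Indep = Matroid.Indep Δ ; indep? = Matroid.indep? Δ ; indep-⊆ = Matroid.indep-⊆ Δ }

basis-rank : ∀ {m} (Δ : Matroid m) {B} → IsBasis Δ B → RankAtMost (matroidSystem Δ) ∣ B ∣
basis-rank Δ {B} (indB , maximal) S indS with ∣ S ∣ ≤? ∣ B ∣
... | yes S≤B = S≤B
... | no  S≰B with Matroid.augment Δ indB indS (ℕ.≰⇒> S≰B)
...   | x , _ , x∉B , indBx = ⊥-elim (maximal x x∉B indBx)

module RestrictedContraction {n d} (d≤n : d ≤ n) (Δ : Matroid n) (basis : IsBasis Δ (initSeg n d))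
         {I : Subset n} (indI : Matroid.Indep Δ I) (I≥d : ∀ x → x ∈ I → d ≤ toℕ x) where

  Δˢ : IndependenceSystem n
  Δˢ = matroidSystem Δ

  [d] : Subset n
  [d] = initSeg n d

  Δ-rank : RankAtMost Δˢ d
  Δ-rank = subst (RankAtMost Δˢ) (∣initSeg∣ d≤n) (basis-rank Δ basis)

  extend-to-size-d : ∀ {A} → Indep Δˢ A → ∃ λ T → Indep Δˢ T × A ⊆ T × T ⊆ A ∪ [d] × ∣ T ∣ ≡ d
  extend-to-size-d indA = augment-to Δˢ (Matroid.augment Δ) d indA (proj₁ basis) (Δ-rank _ indA)
                                     (ℕ.≤-reflexive (sym (∣initSeg∣ d≤n)))

  ι : Fin d → Fin n
  ι g = inject≤ g d≤n

  ι∉I : ∀ g → ι g ∉ I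
  ι∉I g ιg∈I = ℕ.<⇒≱ (subst (_< d) (sym (toℕ-inject≤ g d≤n)) (toℕ<n g)) (I≥d _ ιg∈I)

  ∣embed∪I∣ : ∀ G → ∣ embed G ∪ I ∣ ≡ ∣ G ∣ ℕ.+ ∣ I ∣
  ∣embed∪I∣ G = trans (∣p∪q∣≡∣p∣+∣q∣ (embed G) I disjoint) (cong (ℕ._+ ∣ I ∣) (∣embed∣ d≤n G))
    where
    disjoint : ∀ {x} → x ∈ embed G → x ∉ I
    disjoint x∈G with ∈-embed⁻ d≤n G x∈G
    ... | g , refl , _ = ι∉I g

  embed-mono : ∀ {G H : Subset d} → G ⊆ H → embed {n} G ⊆ embed H
  embed-mono {G} {H} G⊆H x∈G with ∈-embed⁻ d≤n G x∈G
  ... | g , refl , g∈G = ∈-embed⁺ d≤n H (G⊆H g∈G)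

  embed-∪⁅⁆ : ∀ (G : Subset d) g → embed {n} (G ∪ ⁅ g ⁆) ⊆ embed G ∪ ⁅ ι g ⁆
  embed-∪⁅⁆ G g x∈ with ∈-embed⁻ d≤n (G ∪ ⁅ g ⁆) x∈
  ... | h , refl , h∈G∪g with x∈p∪q⁻ G ⁅ g ⁆ h∈G∪g
  ...   | inj₁ h∈G   = p⊆p∪q ⁅ ι g ⁆ (∈-embed⁺ d≤n G h∈G)
  ...   | inj₂ h∈⁅g⁆ =
    subst (λ h → ι h ∈ embed G ∪ ⁅ ι g ⁆) (sym (x∈⁅y⁆⇒x≡y g h∈⁅g⁆)) (q⊆p∪q (embed G) _ (x∈⁅x⁆ (ι g)))

  embed-restrict-∪ : ∀ {T} → I ⊆ T → T ⊆ I ∪ [d] → embed (restrict d≤n T) ∪ I ≡ T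
  embed-restrict-∪ {T} I⊆T T⊆I∪[d] = ⊆-antisym (∪-least embed-restrict⊆T I⊆T) T⊆
    where
    embed-restrict⊆T : embed (restrict d≤n T) ⊆ T
    embed-restrict⊆T y∈ with ∈-embed⁻ d≤n (restrict d≤n T) y∈
    ... | g , refl , g∈ = ∈-restrict⁻ d≤n T g∈
    T⊆ : T ⊆ embed (restrict d≤n T) ∪ I
    T⊆ y∈T with x∈p∪q⁻ I [d] (T⊆I∪[d] y∈T)
    ... | inj₁ y∈I   = q⊆p∪q _ I y∈I
    ... | inj₂ y∈[d] = subst (_∈ _) (sym y≡ιg)
      (p⊆p∪q I (∈-embed⁺ d≤n (restrict d≤n T) (∈-restrict⁺ d≤n T (subst (_∈ T) y≡ιg y∈T))))
      where y≡ιg = toℕ<⇒inject≤ d≤n (∈-initSeg⁻ d≤n y∈[d])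

  Γ : IndependenceSystem d
  Γ = record { Indep = ΓIndep Δ I ; indep? = ΓIndep? Δ I
             ; indep-⊆ = λ G⊆H → indep-⊆ Δˢ (∪-monoˡ-⊆ I (embed-mono G⊆H)) }

  Γ-augmentation : Augmentation Γ
  Γ-augmentation {A} {B} indA indB A<B
    with Matroid.augment Δ indA indB (subst₂ _<_ (sym (∣embed∪I∣ A)) (sym (∣embed∪I∣ B)) (ℕ.+-monoˡ-< ∣ I ∣ A<B))
  ... | x , x∈B∪I , x∉A∪I , indA∪I∪x with x∈p∪q⁻ (embed B) I x∈B∪I
  ...   | inj₂ x∈I = ⊥-elim (x∉A∪I (q⊆p∪q (embed A) I x∈I))
  ...   | inj₁ x∈B with ∈-embed⁻ d≤n B x∈B
  ...     | g , refl , g∈B = g , g∈B , x∉A∪I ∘ p⊆p∪q I ∘ ∈-embed⁺ d≤n A , indep-⊆ Δˢ A∪g∪I⊆ indA∪I∪x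
    where
    A∪g∪I⊆ : embed (A ∪ ⁅ g ⁆) ∪ I ⊆ (embed A ∪ I) ∪ ⁅ ι g ⁆
    A∪g∪I⊆ = ∪-least (∪-least (p⊆p∪q _ ∘ p⊆p∪q I) (q⊆p∪q _ _) ∘ embed-∪⁅⁆ A g) (p⊆p∪q _ ∘ q⊆p∪q (embed A) I)

  Γ-rank : RankAtMost Γ (d ∸ ∣ I ∣)
  Γ-rank G indG = ℕ.m+n≤o⇒m≤o∸n ∣ G ∣ (subst (_≤ d) (∣embed∪I∣ G) (Δ-rank _ indG))

  restrict-Γ : ∀ {T} → Indep Δˢ T → I ⊆ T → T ⊆ I ∪ [d] → ∣ T ∣ ≡ d →
               Indep Γ (restrict d≤n T) × ∣ restrict d≤n T ∣ ≡ d ∸ ∣ I ∣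
  restrict-Γ {T} indT I⊆T T⊆I∪[d] ∣T∣ = subst (Indep Δˢ) (sym T≡) indT , (begin
    ∣ G ∣                          ≡⟨ ℕ.m+n∸n≡m ∣ G ∣ ∣ I ∣ ⟨
    ∣ G ∣ ℕ.+ ∣ I ∣ ∸ ∣ I ∣        ≡⟨ cong (_∸ ∣ I ∣) (trans (sym (∣embed∪I∣ G)) (cong ∣_∣ T≡)) ⟩
    ∣ T ∣ ∸ ∣ I ∣                  ≡⟨ cong (_∸ ∣ I ∣) ∣T∣ ⟩
    d ∸ ∣ I ∣                      ∎)
    where
    open ≡-Reasoning
    G = restrict d≤n T
    T≡ = embed-restrict-∪ I⊆T T⊆I∪[d]

  Γ-hasIndepOfSize : HasIndepOfSize Γ (d ∸ ∣ I ∣)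
  Γ-hasIndepOfSize with extend-to-size-d indI
  ... | T , indT , I⊆T , T⊆I∪[d] , ∣T∣ = restrict d≤n T , restrict-Γ indT I⊆T T⊆I∪[d] ∣T∣

  module _ (none : ¬ ∃ λ (z : Fin n) → d ≤ toℕ z × z ∉ I × Matroid.Indep Δ (I ∪ ⁅ z ⁆)) where

    indep-⊇I⇒⊆I∪[d] : ∀ {T} → Indep Δˢ T → I ⊆ T → T ⊆ I ∪ [d]
    indep-⊇I⇒⊆I∪[d] indT I⊆T {y} y∈T with y ∈? I | toℕ y <? d
    ... | yes y∈I | _       = p⊆p∪q [d] y∈I
    ... | no _    | yes y<d = q⊆p∪q I [d] (∈-initSeg⁺ d≤n y<d)
    ... | no y∉I  | no y≮d  = ⊥-elim (none (y , ℕ.≮⇒≥ y≮d , y∉I , indep-⊆ Δˢ (∪-least I⊆T (⁅x⁆⊆p y∈T)) indT))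

    -- The trace G of T on [d] has full rank in Γ, so G ∪ ⁅ g ⁆ can only be independent if g ∈ G.
    Γ-coloop∈ : ∀ {g} → IsColoop Γ g → ∀ {T} → Indep Δˢ T → I ⊆ T → ∣ T ∣ ≡ d → ι g ∈ T
    Γ-coloop∈ {g} coloop {T} indT I⊆T ∣T∣ with g ∈? restrict d≤n T
    ... | yes g∈G = ∈-restrict⁻ d≤n T g∈G
    ... | no  g∉G with restrict-Γ indT I⊆T (indep-⊇I⇒⊆I∪[d] indT I⊆T) ∣T∣
    ...   | indG , ∣G∣ = ⊥-elim (ℕ.1+n≰n (begin
      suc (d ∸ ∣ I ∣)                ≡⟨ cong suc ∣G∣ ⟨
      suc ∣ restrict d≤n T ∣         ≡⟨ x∉p⇒∣p∪⁅x⁆∣≡1+∣p∣ _ g∉G ⟨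
      ∣ restrict d≤n T ∪ ⁅ g ⁆ ∣     ≤⟨ Γ-rank _ (coloop _ indG) ⟩
      d ∸ ∣ I ∣                      ∎))
      where open ℕ.≤-Reasoning

    -- Complete S to a basis B through [d] and I to a basis T inside I ∪ B; then ι g ∈ T ∖ I ⊆ B.
    Γ-coloop⇒coloop : ∀ {g} → IsColoop Γ g → IsColoop Δˢ (ι g)
    Γ-coloop⇒coloop {g} coloop S indS with extend-to-size-d indS
    ... | B , indB , S⊆B , _ , ∣B∣
      with augment-to Δˢ (Matroid.augment Δ) d indI indB (Δ-rank I indI) (ℕ.≤-reflexive (sym ∣B∣))
    ...   | T , indT , I⊆T , T⊆I∪B , ∣T∣ with x∈p∪q⁻ I B (T⊆I∪B (Γ-coloop∈ coloop indT I⊆T ∣T∣))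
    ...     | inj₁ ιg∈I = ⊥-elim (ι∉I g ιg∈I)
    ...     | inj₂ ιg∈B = indep-⊆ Δˢ (∪-least S⊆B (⁅x⁆⊆p ιg∈B)) indB

mainTheorem5 : (n d : ℕ) → d ≤ n → (Δ : Matroid n) →
    IsBasis Δ (initSeg n d) →
    hVec Δ d d ≢ + 0 →
    (I : Subset n) → Matroid.Indep Δ I →
    (∀ x → x ∈ I → d ≤ toℕ x) →
    hΓ d Δ I (d ∸ ∣ I ∣) ≡ + 0 →
    ∃ λ (z : Fin n) → d ≤ toℕ z × z ∉ I × Matroid.Indep Δ (I ∪ ⁅ z ⁆)
mainTheorem5 n d d≤n Δ basis hΔ≢0 I indI I≥d hΓ≡0 =
  decidable-stable (any? λ z → d ≤? toℕ z ×-dec ¬? (z ∈? I) ×-dec Matroid.indep? Δ (I ∪ ⁅ z ⁆)) λ none →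
    Sum.[ (λ hΓ>0 → ℤ.<⇒≢ hΓ>0 (trans (sym hΓ≡0) hΓ≡signedCount))
        , (λ (g , coloop) → hΔ≢0 (trans hΔ≡signedCount
                                 (signedCount-coloop Δˢ d Δ-rank (ι g) (Γ-coloop⇒coloop none coloop)))) ]′
      (signedCount-positiveOrColoop Γ Γ-augmentation (d ∸ ∣ I ∣) Γ-rank Γ-hasIndepOfSize)
  where
  open RestrictedContraction d≤n Δ basis indI I≥d
  hΓ≡signedCount : hΓ d Δ I (d ∸ ∣ I ∣) ≡ signedCount Γ (d ∸ ∣ I ∣)
  hΓ≡signedCount = hEntry-top≡signedCount Γ (d ∸ ∣ I ∣) Γ-rank
  hΔ≡signedCount : hVec Δ d d ≡ signedCount Δˢ d
  hΔ≡signedCount = hEntry-top≡signedCount Δˢ d Δ-rank
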